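{- Let $p$ be an odd prime and $d\ge1$. Let $e_1,\dots,e_d$, $f_1,\dots,f_d$ be the standard bases of the two factors of $\mathbb{Z}_p^d\times\mathbb{Z}_p^d\cong\mathbb{Z}_p^{2d}$, and let $S=A\cup B$ where $$A=\Big\{\big(\textstyle\sum_{i=1}^{k}e_i,\ \sum_{j=1}^{k-1}f_j\big): 1\le k\le d\Big\},\quad B=\Big\{\big(\textstyle\sum_{i=1}^{k-1}e_i+2e_k,\ \sum_{j=1}^{k}f_j\big): 1\le k\le d\Big\}.$$ Regard $C_p^{2d}$ as the Cayley graph $Y=\mathrm{Cay}(\mathbb{Z}_p^{2d},S\cup(-S))$. Define $\kappa_+,\kappa_-:\mathbb{Z}_p^{2d}\times\mathbb{Z}_p^{2d}\to\mathbb{Z}_p$ by $\kappa_+((\bar a,\bar b),(\bar c,\bar d))=\bar b\cdot\bar c$ and $\kappa_-((\bar a,\bar b),(\bar c,\bar d))=\bar b\cdot\bar c+\phi(a_1,c_1)$, where $a_1,c_1$ are the first coordinates of $\bar a,\bar c$ and $\phi(x,y)=1$ if $\iota(x)+\iota(y)\ge p$, $\phi(x,y)=0$ otherwise ($\iota$ the representative map $\mathbb{Z}_p\to\{0,\dots,p-1\}$). Define $f_\pm:\mathbb{Z}_p^{2d}\times\mathbb{Z}_p^{2d}\to\mathbb{Z}_p\cup\{\ast\}$ by setting, for each $s\in S$ and $g\in\mathbb{Z}_p^{2d}$, $f_\pm(g,s+g)=\kappa_\pm(s,g)$ and $f_\pm(s+g,g)=-\kappa_\pm(s,g)$, and $f_\pm(u,v)=\ast$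 whenever $\{u,v\}$ is not an edge of $Y$. Then the cover of $Y$ associated with the gain graph $(Y,f_+)$ is isomorphic to $\mathrm{Cay}(G_+,S_+)$, and the cover associated with $(Y,f_-)$ is isomorphic to $\mathrm{Cay}(G_-,S_-)$.
   Context: $G_\pm$ is the group on $\mathbb{Z}_p^{2d}\times\mathbb{Z}_p$ with multiplication $(x,z)(y,w)=(x+y,\ z+w+\kappa_\pm(x,y))$ (these are the extraspecial $p$-groups of order $p^{1+2d}$ of exponent $p$, resp. $p^2$). With $\epsilon(x)=(x,0)$, $S_\pm=\epsilon(S)\cup\epsilon(S)^{ -1}$, inverses taken in $G_\pm$. $\mathrm{Cay}(G,T)$ has vertex set $G$ and $\{g,h\}$ an edge iff $gh^{ -1}\in T$. A gain graph $(Y,f)$ with gains in $\mathbb{Z}_p$ consists of a graph $Y$ and $f:V\times V\to\mathbb{Z}_p\cup\{\ast\}$ with $f(u,v)=\ast$ iff $\{u,v\}\notin E(Y)$ and $f(v,u)=-f(u,v)$ otherwise; its associated cover is the graph with vertex set $V(Y)\times\mathbb{Z}_p$ in which $(v,j)\sim(u,k)$ iff $u\sim_Y v$ and $k=j+f(u,v)$ (here $\mathbb{Z}_p$ acts on itself by translation; equivalently the gains may be viewed as $p$th roots of unity). -}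

module Defs where

open import Data.Nat as ℕ using (ℕ; zero; suc; NonZero; _<_; _≤_; _≥_; z≤n; s≤s; _<?_; _≤?_; _∸_)
open import Data.Nat.DivMod using (_%_; m%n<n)
open import Data.Fin as F using (Fin; toℕ; fromℕ<)
open import Data.Fin.Properties as FP using (any?)
open import Data.Vec as V using (Vec; tabulate; zipWith; foldr; lookup)
open import Data.Vec.Properties as VP using ()
open import Data.Product using (Σ; _×_; _,_; proj₁; proj₂)
open import Data.Product.Properties as PP using ()
open import Data.Sum using (_⊎_; inj₁; inj₂)
open import Data.Sum.Base using () renaming (_⊎_ to _⊎′_)
open import Data.Maybe using (Maybe; just; nothing)
open import Relation.Nullary using (Dec; yes; no)
open import Relation.Nullary.Decidable using (_⊎-dec_)
open import Relation.Binary.PropositionalEquality using (_≡_)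
open import Function.Bundles using (_↔_; Inverse)

GraphIso : {A B : Set} → (A → A → Set) → (B → B → Set) → Set
GraphIso {A} {B} R Q =
  Σ (A ↔ B) λ φ → ∀ x y →
    (R x y → Q (Inverse.to φ x) (Inverse.to φ y)) ×
    (Q (Inverse.to φ x) (Inverse.to φ y) → R x y)

module Construction (p : ℕ) {{_ : NonZero p}} (d : ℕ) (hd : 1 ≤ d) where

  Zp : Set
  Zp = Fin p

  ι : Zp → ℕ
  ι = toℕ

  mod : ℕ → Zp
  mod n = fromℕ< (m%n<n n p)

  0ₚ 1ₚ 2ₚ : Zp
  0ₚ = mod 0
  1ₚ = mod 1
  2ₚ = mod 2

  _+ₚ_ : Zp → Zp → Zp
  a +ₚ b = mod (ι a ℕ.+ ι b)

  _*ₚ_ : Zp → Zp → Zp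
  a *ₚ b = mod (ι a ℕ.* ι b)

  -ₚ_ : Zp → Zp
  -ₚ a = mod (p ∸ ι a)

  Vd : Set
  Vd = Vec Zp d

  _+ᵥ_ : Vd → Vd → Vd
  _+ᵥ_ = zipWith _+ₚ_

  -ᵥ_ : Vd → Vd
  -ᵥ_ = V.map -ₚ_

  0ᵥ : Vd
  0ᵥ = V.replicate d 0ₚ

  _·_ : Vd → Vd → Zp
  u · v = foldr (λ _ → Zp) _+ₚ_ 0ₚ (zipWith _*ₚ_ u v)

  P : Set
  P = Vd × Vd

  _+ᴾ_ : P → P → P
  (a , b) +ᴾ (c , e) = (a +ᵥ c , b +ᵥ e)

  -ᴾ_ : P → P
  -ᴾ (a , b) = (-ᵥ a , -ᵥ b)

  0ᴾ : P
  0ᴾ = (0ᵥ , 0ᵥ)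

  _≟ᴾ_ : (x y : P) → Dec (x ≡ y)
  _≟ᴾ_ = PP.≡-dec (VP.≡-dec FP._≟_) (VP.≡-dec FP._≟_)

  -- The generating set S = A ∪ B.  Index k : Fin d stands for k+1 ∈ {1..d};
  -- coordinate i : Fin d stands for i+1.
  -- A_k = (e_1+…+e_k , f_1+…+f_{k-1})
  -- B_k = (e_1+…+e_{k-1}+2e_k , f_1+…+f_k)
  ind< : Fin d → Fin d → Zp
  ind< k i with toℕ i <? toℕ k
  ... | yes _ = 1ₚ
  ... | no  _ = 0ₚ

  ind≤ : Fin d → Fin d → Zp
  ind≤ k i with toℕ i ≤? toℕ k
  ... | yes _ = 1ₚ
  ... | no  _ = 0ₚ

  indB : Fin d → Fin d → Zp
  indB k i with toℕ i <? toℕ k | toℕ i ℕ.≟ toℕ k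
  ... | yes _ | _     = 1ₚ
  ... | no  _ | yes _ = 2ₚ
  ... | no  _ | no _  = 0ₚ

  aElt : Fin d → P
  aElt k = (tabulate (ind≤ k) , tabulate (ind< k))

  bElt : Fin d → P
  bElt k = (tabulate (indB k) , tabulate (ind≤ k))

  InS : P → Set
  InS x = Σ (Fin d) λ k → (x ≡ aElt k) ⊎ (x ≡ bElt k)

  InS? : (x : P) → Dec (InS x)
  InS? x = any? (λ k → (x ≟ᴾ aElt k) ⊎-dec (x ≟ᴾ bElt k))

  InS± : P → Set
  InS± x = InS x ⊎ Σ P (λ s → InS s × x ≡ -ᴾ s)

  YAdj : P → P → Set
  YAdj g h = InS± (g +ᴾ (-ᴾ h))

  first : Vd → Zp
  first a = lookup a (fromℕ< hd)

  φ : Zp → Zp → Zp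
  φ x y with p ≤? ι x ℕ.+ ι y
  ... | yes _ = 1ₚ
  ... | no  _ = 0ₚ

  κ₊ : P → P → Zp
  κ₊ (a , b) (c , e) = b · c

  κ₋ : P → P → Zp
  κ₋ (a , b) (c , e) = (b · c) +ₚ φ (first a) (first c)

  gain : (P → P → Zp) → P → P → Maybe Zp
  gain κ u v with InS? (v +ᴾ (-ᴾ u)) | InS? (u +ᴾ (-ᴾ v))
  ... | yes _ | _     = just (κ (v +ᴾ (-ᴾ u)) u)
  ... | no  _ | yes _ = just (-ₚ κ (u +ᴾ (-ᴾ v)) v)
  ... | no  _ | no  _ = nothing

  CoverAdj : (P → P → Maybe Zp) → P × Zp → P × Zp → Set
  CoverAdj f (v , j) (u , k) =
    YAdj u v × Σ Zp (λ c → (f u v ≡ just c) × (k ≡ j +ₚ c))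

  G : Set
  G = P × Zp

  mul : (P → P → Zp) → G → G → G
  mul κ (x , z) (y , w) = (x +ᴾ y , (z +ₚ w) +ₚ κ x y)

  inv : (P → P → Zp) → G → G
  inv κ (x , z) = (-ᴾ x , -ₚ (z +ₚ κ x (-ᴾ x)))

  ε : P → G
  ε x = (x , 0ₚ)

  InSG : (P → P → Zp) → G → Set
  InSG κ g = Σ P λ s → InS s × ((g ≡ ε s) ⊎ (g ≡ inv κ (ε s)))

  CayAdj : (P → P → Zp) → G → G → Set
  CayAdj κ g h = InSG κ (mul κ g (inv κ h))

module Submission where

-- For a normalised 2-cocycle κ on P = Z_p^{2d} with values in Z_p, the cocycle
-- identity makes (x , z)(y , w) = (x + y , z + w + κ(x , y)) a group G_κ, in which g h⁻¹ equals
-- ε(s) resp. ε(s)⁻¹ exactly when g = ε(s) h resp. h = ε(s) g.  As ε(s)(u , z) = (s + u , z + κ(s , u)),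
-- the bijection (v , j) ↦ (v , −j) carries the edges of the cover of (Y , f_κ), which lift u → s + u
-- with gain κ(s , u), onto the edges of Cay(G_κ, S_κ); this uses S ∩ −S = ∅, so that f_κ(u , v) is
-- computed from the generator joining u and v.  κ₊ is biadditive, and κ₋ is κ₊ plus the carry
-- cocycle φ(x , y) = ⌊(ι x + ι y)/p⌋ of Z_p pulled back along the first coordinate, so both are
-- normalised cocycles.  Finally S ∩ −S = ∅ since the first coordinates of the two halves of an
-- element of S are (1,0), (1,1) or (2,1), and no two of these pairs add up to (0,0) when p ≥ 3.

open import Defs
open import Algebra.Bundles using (Group; AbelianGroup; CommutativeRing)
open import Algebra.Structures using (IsAbelianGroup)
open import Algebra.Consequences.Propositional
  using (comm∧idˡ⇒id; comm∧invˡ⇒inv; comm∧distrˡ⇒distrʳ; comm∧assoc⇒middleFour)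
open import Data.Fin using (zero; suc; fromℕ<)
import Data.Fin.Properties as Finₚ
open import Data.Maybe using (just)
open import Data.Maybe.Properties using (just-injective)
open import Data.Nat as ℕ using (ℕ; zero; suc; NonZero; _≤_; _<_; z≤n; s≤s; _∸_)
open import Data.Nat.Divisibility using (_∤_; ∣-refl; n∣m*n)
open import Data.Nat.DivMod
  using (_%_; _/_; m%n<n; m%n%n≡m%n; %-distribˡ-+; %-distribˡ-*; n%n≡0;
         m<n⇒m%n≡m; m<n⇒m/n≡0; m/n≡1+[m∸n]/n; m≡m%n+[m/n]*n; +-distrib-/-∣ʳ; m*n/n≡m)
import Data.Nat.Properties as ℕₚ
open import Data.Nat.Primality using (Prime; ¬prime[0]; ¬prime[1])
open import Data.Product using (Σ; _×_; _,_; proj₁; proj₂)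
open import Data.Sum using (_⊎_; inj₁; inj₂)
open import Data.Sum.Function.Propositional using (_⊎-⇔_)
open import Data.Vec as V using (Vec; []; _∷_)
import Data.Vec.Properties as Vecₚ
open import Data.Empty using (⊥-elim)
open import Function.Bundles using (_⇔_; mk⇔; Equivalence; mk↔ₛ′)
open import Function.Construct.Composition using (_⇔-∘_)
open import Function.Construct.Symmetry using (⇔-sym)
open import Relation.Binary.PropositionalEquality hiding (setoid)
open import Relation.Nullary using (¬_; yes; no)
import Algebra.Properties.CommutativeSemigroup
import Algebra.Properties.Group
import Algebra.Properties.AbelianGroup

module _ {c ℓ} (𝔾 : Group c ℓ) where
  open Group 𝔾
  open import Algebra.Properties.Group 𝔾
  open import Relation.Binary.Reasoning.Setoid setoid

  //≈⇔≈∙ : ∀ {x y z} → x // y ≈ z ⇔ x ≈ z ∙ y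
  //≈⇔≈∙ {x} {y} {z} = mk⇔
    (λ e → begin
      x              ≈⟨ //-rightDividesˡ y x ⟨
      (x // y) ∙ y   ≈⟨ ∙-congʳ e ⟩
      z ∙ y          ∎)
    (λ e → begin
      x // y         ≈⟨ ∙-congʳ e ⟩
      (z ∙ y) // y   ≈⟨ //-rightDividesʳ y z ⟩
      z              ∎)

  //≈⁻¹⇔≈∙ : ∀ {x y z} → x // y ≈ z ⁻¹ ⇔ y ≈ z ∙ x
  //≈⁻¹⇔≈∙ {x} {y} {z} = mk⇔
    (λ e → Equivalence.to //≈⇔≈∙ (begin
      y // x         ≈⟨ ⁻¹-anti-homo-// x y ⟨
      (x // y) ⁻¹    ≈⟨ ⁻¹-cong e ⟩
      z ⁻¹ ⁻¹        ≈⟨ ⁻¹-involutive z ⟩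
      z              ∎))
    (λ e → begin
      x // y         ≈⟨ ⁻¹-anti-homo-// y x ⟨
      (y // x) ⁻¹    ≈⟨ ⁻¹-cong (Equivalence.from //≈⇔≈∙ e) ⟩
      z ⁻¹           ∎)

-- The modulus is written suc q so that ι 0ₚ reduces to 0.
module ConstructionProperties (q d : ℕ) (hd : 1 ≤ d) where
  open Construction (suc q) d hd
  open ≡-Reasoning

  private
    p : ℕ
    p = suc q
    module ℕ+ = Algebra.Properties.CommutativeSemigroup ℕₚ.+-commutativeSemigroup

  ι-mod : ∀ m → ι (mod m) ≡ m % p
  ι-mod m = Finₚ.toℕ-fromℕ< (m%n<n m p)

  mod-% : ∀ m → mod (m % p) ≡ mod m
  mod-% m = Finₚ.toℕ-injective (trans (ι-mod (m % p)) (trans (m%n%n≡m%n m p) (sym (ι-mod m))))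

  mod-ι : ∀ a → mod (ι a) ≡ a
  mod-ι a = Finₚ.toℕ-injective (trans (ι-mod (ι a)) (m<n⇒m%n≡m (Finₚ.toℕ<n a)))

  mod-+ : ∀ m n → mod m +ₚ mod n ≡ mod (m ℕ.+ n)
  mod-+ m n = begin
    mod (ι (mod m) ℕ.+ ι (mod n)) ≡⟨ cong₂ (λ x y → mod (x ℕ.+ y)) (ι-mod m) (ι-mod n) ⟩
    mod (m % p ℕ.+ n % p)         ≡⟨ mod-% (m % p ℕ.+ n % p) ⟨
    mod ((m % p ℕ.+ n % p) % p)   ≡⟨ cong mod (%-distribˡ-+ m n p) ⟨
    mod ((m ℕ.+ n) % p)           ≡⟨ mod-% (m ℕ.+ n) ⟩
    mod (m ℕ.+ n)                 ∎

  mod-* : ∀ m n → mod m *ₚ mod n ≡ mod (m ℕ.* n)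
  mod-* m n = begin
    mod (ι (mod m) ℕ.* ι (mod n)) ≡⟨ cong₂ (λ x y → mod (x ℕ.* y)) (ι-mod m) (ι-mod n) ⟩
    mod (m % p ℕ.* (n % p))       ≡⟨ mod-% (m % p ℕ.* (n % p)) ⟨
    mod ((m % p ℕ.* (n % p)) % p) ≡⟨ cong mod (%-distribˡ-* m n p) ⟨
    mod ((m ℕ.* n) % p)           ≡⟨ mod-% (m ℕ.* n) ⟩
    mod (m ℕ.* n)                 ∎

  +ₚ-comm : ∀ a b → a +ₚ b ≡ b +ₚ a
  +ₚ-comm a b = cong mod (ℕₚ.+-comm (ι a) (ι b))

  *ₚ-comm : ∀ a b → a *ₚ b ≡ b *ₚ a
  *ₚ-comm a b = cong mod (ℕₚ.*-comm (ι a) (ι b))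

  +ₚ-assoc : ∀ a b c → (a +ₚ b) +ₚ c ≡ a +ₚ (b +ₚ c)
  +ₚ-assoc a b c = begin
    mod (ι a ℕ.+ ι b) +ₚ c          ≡⟨ cong ((a +ₚ b) +ₚ_) (mod-ι c) ⟨
    mod (ι a ℕ.+ ι b) +ₚ mod (ι c)  ≡⟨ mod-+ (ι a ℕ.+ ι b) (ι c) ⟩
    mod (ι a ℕ.+ ι b ℕ.+ ι c)       ≡⟨ cong mod (ℕₚ.+-assoc (ι a) (ι b) (ι c)) ⟩
    mod (ι a ℕ.+ (ι b ℕ.+ ι c))     ≡⟨ mod-+ (ι a) (ι b ℕ.+ ι c) ⟨
    mod (ι a) +ₚ mod (ι b ℕ.+ ι c)  ≡⟨ cong (_+ₚ (b +ₚ c)) (mod-ι a) ⟩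
    a +ₚ (b +ₚ c)                   ∎

  *ₚ-assoc : ∀ a b c → (a *ₚ b) *ₚ c ≡ a *ₚ (b *ₚ c)
  *ₚ-assoc a b c = begin
    mod (ι a ℕ.* ι b) *ₚ c          ≡⟨ cong ((a *ₚ b) *ₚ_) (mod-ι c) ⟨
    mod (ι a ℕ.* ι b) *ₚ mod (ι c)  ≡⟨ mod-* (ι a ℕ.* ι b) (ι c) ⟩
    mod (ι a ℕ.* ι b ℕ.* ι c)       ≡⟨ cong mod (ℕₚ.*-assoc (ι a) (ι b) (ι c)) ⟩
    mod (ι a ℕ.* (ι b ℕ.* ι c))     ≡⟨ mod-* (ι a) (ι b ℕ.* ι c) ⟨
    mod (ι a) *ₚ mod (ι b ℕ.* ι c)  ≡⟨ cong (_*ₚ (b *ₚ c)) (mod-ι a) ⟩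
    a *ₚ (b *ₚ c)                   ∎

  *ₚ-distribˡ-+ₚ : ∀ a b c → a *ₚ (b +ₚ c) ≡ (a *ₚ b) +ₚ (a *ₚ c)
  *ₚ-distribˡ-+ₚ a b c = begin
    a *ₚ mod (ι b ℕ.+ ι c)             ≡⟨ cong (_*ₚ (b +ₚ c)) (mod-ι a) ⟨
    mod (ι a) *ₚ mod (ι b ℕ.+ ι c)     ≡⟨ mod-* (ι a) (ι b ℕ.+ ι c) ⟩
    mod (ι a ℕ.* (ι b ℕ.+ ι c))        ≡⟨ cong mod (ℕₚ.*-distribˡ-+ (ι a) (ι b) (ι c)) ⟩
    mod (ι a ℕ.* ι b ℕ.+ ι a ℕ.* ι c)  ≡⟨ mod-+ (ι a ℕ.* ι b) (ι a ℕ.* ι c) ⟨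
    (a *ₚ b) +ₚ (a *ₚ c)               ∎

  +ₚ-identityˡ : ∀ a → 0ₚ +ₚ a ≡ a
  +ₚ-identityˡ = mod-ι

  *ₚ-identityˡ : ∀ a → 1ₚ *ₚ a ≡ a
  *ₚ-identityˡ a = begin
    1ₚ *ₚ a             ≡⟨ cong (1ₚ *ₚ_) (mod-ι a) ⟨
    mod 1 *ₚ mod (ι a)  ≡⟨ mod-* 1 (ι a) ⟩
    mod (1 ℕ.* ι a)     ≡⟨ cong mod (ℕₚ.*-identityˡ (ι a)) ⟩
    mod (ι a)           ≡⟨ mod-ι a ⟩
    a                   ∎

  -ₚ-inverseˡ : ∀ a → (-ₚ a) +ₚ a ≡ 0ₚ
  -ₚ-inverseˡ a = begin
    mod (p ∸ ι a) +ₚ a          ≡⟨ cong ((-ₚ a) +ₚ_) (mod-ι a) ⟨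
    mod (p ∸ ι a) +ₚ mod (ι a)  ≡⟨ mod-+ (p ∸ ι a) (ι a) ⟩
    mod (p ∸ ι a ℕ.+ ι a)       ≡⟨ cong mod (ℕₚ.m∸n+n≡m (ℕₚ.<⇒≤ (Finₚ.toℕ<n a))) ⟩
    mod p                       ≡⟨ mod-% p ⟨
    mod (p % p)                 ≡⟨ cong mod (n%n≡0 p) ⟩
    0ₚ                          ∎

  Zp-commutativeRing : CommutativeRing _ _
  Zp-commutativeRing = record
    { Carrier = Zp ; _≈_ = _≡_ ; _+_ = _+ₚ_ ; _*_ = _*ₚ_ ; -_ = -ₚ_ ; 0# = 0ₚ ; 1# = 1ₚ
    ; isCommutativeRing = record
      { isRing = record
        { +-isAbelianGroup = record
          { isGroup = record
            { isMonoid = record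
              { isSemigroup = record
                { isMagma = record { isEquivalence = isEquivalence ; ∙-cong = cong₂ _+ₚ_ }
                ; assoc = +ₚ-assoc }
              ; identity = comm∧idˡ⇒id +ₚ-comm +ₚ-identityˡ }
            ; inverse = comm∧invˡ⇒inv +ₚ-comm -ₚ-inverseˡ
            ; ⁻¹-cong = cong -ₚ_ }
          ; comm = +ₚ-comm }
        ; *-cong = cong₂ _*ₚ_
        ; *-assoc = *ₚ-assoc
        ; *-identity = comm∧idˡ⇒id *ₚ-comm *ₚ-identityˡ
        ; distrib = *ₚ-distribˡ-+ₚ , comm∧distrˡ⇒distrʳ *ₚ-comm *ₚ-distribˡ-+ₚ }
      ; *-comm = *ₚ-comm } }

  open CommutativeRing Zp-commutativeRing
    using (+-identityˡ; +-identityʳ; +-assoc; +-comm; +-group; -‿inverseˡ; -‿inverseʳ; distribʳ; distribˡ)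
  open import Algebra.Properties.Group +-group using (identityˡ-unique; identityʳ-unique)
  private
    module Zpₚ = Algebra.Properties.AbelianGroup (CommutativeRing.+-abelianGroup Zp-commutativeRing)
    module Zp+ = Algebra.Properties.CommutativeSemigroup (CommutativeRing.+-commutativeSemigroup Zp-commutativeRing)
  open import Algebra.Solver.CommutativeMonoid (CommutativeRing.+-commutativeMonoid Zp-commutativeRing)
    using (solve; _⊜_; _⊕_)

  +ₚ-middleFour : ∀ w x y z → (w +ₚ x) +ₚ (y +ₚ z) ≡ (w +ₚ y) +ₚ (x +ₚ z)
  +ₚ-middleFour = comm∧assoc⇒middleFour +-comm +-assoc

  Vd-isAbelianGroup : IsAbelianGroup _≡_ _+ᵥ_ 0ᵥ -ᵥ_
  Vd-isAbelianGroup = record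
    { isGroup = record
      { isMonoid = record
        { isSemigroup = record
          { isMagma = record { isEquivalence = isEquivalence ; ∙-cong = cong₂ _+ᵥ_ }
          ; assoc = Vecₚ.zipWith-assoc +-assoc }
        ; identity = Vecₚ.zipWith-identityˡ +-identityˡ , Vecₚ.zipWith-identityʳ +-identityʳ }
      ; inverse = Vecₚ.zipWith-inverseˡ -‿inverseˡ , Vecₚ.zipWith-inverseʳ -‿inverseʳ
      ; ⁻¹-cong = cong -ᵥ_ }
    ; comm = Vecₚ.zipWith-comm +-comm }

  private module Vd = IsAbelianGroup Vd-isAbelianGroup

  P-abelianGroup : AbelianGroup _ _
  P-abelianGroup = record
    { Carrier = P ; _≈_ = _≡_ ; _∙_ = _+ᴾ_ ; ε = 0ᴾ ; _⁻¹ = -ᴾ_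
    ; isAbelianGroup = record
      { isGroup = record
        { isMonoid = record
          { isSemigroup = record
            { isMagma = record { isEquivalence = isEquivalence ; ∙-cong = cong₂ _+ᴾ_ }
            ; assoc = λ (a , b) (c , e) (f , g) → cong₂ _,_ (Vd.assoc a c f) (Vd.assoc b e g) }
          ; identity = (λ (a , b) → cong₂ _,_ (Vd.identityˡ a) (Vd.identityˡ b))
                     , (λ (a , b) → cong₂ _,_ (Vd.identityʳ a) (Vd.identityʳ b)) }
        ; inverse = (λ (a , b) → cong₂ _,_ (Vd.inverseˡ a) (Vd.inverseˡ b))
                  , (λ (a , b) → cong₂ _,_ (Vd.inverseʳ a) (Vd.inverseʳ b))
        ; ⁻¹-cong = cong -ᴾ_ }
      ; comm = λ (a , b) (c , e) → cong₂ _,_ (Vd.comm a c) (Vd.comm b e) } }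

  private module Pᵍ = AbelianGroup P-abelianGroup

  P-group : Group _ _
  P-group = AbelianGroup.group P-abelianGroup

  private module Pₚ = Algebra.Properties.Group P-group

  -- _·_ at every length, so that its properties can be proved by induction.
  dot : ∀ {n} → Vec Zp n → Vec Zp n → Zp
  dot u v = V.foldr (λ _ → Zp) _+ₚ_ 0ₚ (V.zipWith _*ₚ_ u v)

  dot-distribʳ : ∀ {n} (a b c : Vec Zp n) → dot (V.zipWith _+ₚ_ a b) c ≡ dot a c +ₚ dot b c
  dot-distribʳ [] [] [] = sym (+-identityʳ 0ₚ)
  dot-distribʳ (x ∷ a) (y ∷ b) (z ∷ c) = begin
    ((x +ₚ y) *ₚ z) +ₚ dot (V.zipWith _+ₚ_ a b) c   ≡⟨ cong₂ _+ₚ_ (distribʳ z x y) (dot-distribʳ a b c) ⟩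
    ((x *ₚ z) +ₚ (y *ₚ z)) +ₚ (dot a c +ₚ dot b c)  ≡⟨ +ₚ-middleFour (x *ₚ z) (y *ₚ z) (dot a c) (dot b c) ⟩
    ((x *ₚ z) +ₚ dot a c) +ₚ ((y *ₚ z) +ₚ dot b c)  ∎

  dot-distribˡ : ∀ {n} (a b c : Vec Zp n) → dot a (V.zipWith _+ₚ_ b c) ≡ dot a b +ₚ dot a c
  dot-distribˡ [] [] [] = sym (+-identityʳ 0ₚ)
  dot-distribˡ (x ∷ a) (y ∷ b) (z ∷ c) = begin
    (x *ₚ (y +ₚ z)) +ₚ dot a (V.zipWith _+ₚ_ b c)   ≡⟨ cong₂ _+ₚ_ (distribˡ x y z) (dot-distribˡ a b c) ⟩
    ((x *ₚ y) +ₚ (x *ₚ z)) +ₚ (dot a b +ₚ dot a c)  ≡⟨ +ₚ-middleFour (x *ₚ y) (x *ₚ z) (dot a b) (dot a c) ⟩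
    ((x *ₚ y) +ₚ dot a b) +ₚ ((x *ₚ z) +ₚ dot a c)  ∎

  first-+ : ∀ a c → first (a +ᵥ c) ≡ first a +ₚ first c
  first-+ a c = Vecₚ.lookup-zipWith _+ₚ_ _ a c

  first-0 : first 0ᵥ ≡ 0ₚ
  first-0 = Vecₚ.lookup-replicate (fromℕ< hd) 0ₚ

  record IsNormalisedCocycle {A : Set} (_∙_ : A → A → A) (e : A) (κ : A → A → Zp) : Set where
    field
      cocycle : ∀ x y z → κ x y +ₚ κ (x ∙ y) z ≡ κ y z +ₚ κ x (y ∙ z)
      zeroˡ   : ∀ x → κ e x ≡ 0ₚ
      zeroʳ   : ∀ x → κ x e ≡ 0ₚ

  module _ {A : Set} {_∙_ : A → A → A} {e : A} where

    +-normalisedCocycle : ∀ {κ κ′} → IsNormalisedCocycle _∙_ e κ → IsNormalisedCocycle _∙_ e κ′ →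
                          IsNormalisedCocycle _∙_ e (λ x y → κ x y +ₚ κ′ x y)
    +-normalisedCocycle {κ} {κ′} c c′ = record
      { cocycle = λ x y z → begin
          (κ x y +ₚ κ′ x y) +ₚ (κ (x ∙ y) z +ₚ κ′ (x ∙ y) z)
            ≡⟨ +ₚ-middleFour (κ x y) (κ′ x y) _ _ ⟩
          (κ x y +ₚ κ (x ∙ y) z) +ₚ (κ′ x y +ₚ κ′ (x ∙ y) z)
            ≡⟨ cong₂ _+ₚ_ (C.cocycle x y z) (C′.cocycle x y z) ⟩
          (κ y z +ₚ κ x (y ∙ z)) +ₚ (κ′ y z +ₚ κ′ x (y ∙ z))
            ≡⟨ +ₚ-middleFour (κ y z) (κ x (y ∙ z)) _ _ ⟩
          (κ y z +ₚ κ′ y z) +ₚ (κ x (y ∙ z) +ₚ κ′ x (y ∙ z)) ∎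
      ; zeroˡ = λ x → trans (cong₂ _+ₚ_ (C.zeroˡ x) (C′.zeroˡ x)) (+-identityʳ 0ₚ)
      ; zeroʳ = λ x → trans (cong₂ _+ₚ_ (C.zeroʳ x) (C′.zeroʳ x)) (+-identityʳ 0ₚ)
      }
      where
      module C = IsNormalisedCocycle c
      module C′ = IsNormalisedCocycle c′

    pullback-normalisedCocycle : ∀ {B : Set} {_∘_ : B → B → B} {e′ : B} {κ} (f : B → A) →
                                 (∀ x y → f (x ∘ y) ≡ f x ∙ f y) → f e′ ≡ e →
                                 IsNormalisedCocycle _∙_ e κ →
                                 IsNormalisedCocycle _∘_ e′ (λ x y → κ (f x) (f y))
    pullback-normalisedCocycle {κ = κ} f f-∘ f-e c = record
      { cocycle = λ x y z → begin
          κ (f x) (f y) +ₚ κ (f _) (f z)          ≡⟨ cong (λ w → κ (f x) (f y) +ₚ κ w (f z)) (f-∘ x y) ⟩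
          κ (f x) (f y) +ₚ κ (f x ∙ f y) (f z)    ≡⟨ C.cocycle (f x) (f y) (f z) ⟩
          κ (f y) (f z) +ₚ κ (f x) (f y ∙ f z)    ≡⟨ cong (λ w → κ (f y) (f z) +ₚ κ (f x) w) (f-∘ y z) ⟨
          κ (f y) (f z) +ₚ κ (f x) (f _)          ∎
      ; zeroˡ = λ x → trans (cong (λ w → κ w (f x)) f-e) (C.zeroˡ (f x))
      ; zeroʳ = λ x → trans (cong (κ (f x)) f-e) (C.zeroʳ (f x))
      }
      where
      module C = IsNormalisedCocycle c

  carry : Zp → Zp → ℕ
  carry x y = (ι x ℕ.+ ι y) / p

  φ≡mod-carry : ∀ x y → φ x y ≡ mod (carry x y)
  φ≡mod-carry x y with p ℕ.≤? ι x ℕ.+ ι y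
  ... | no  p≰s = cong mod (sym (m<n⇒m/n≡0 (ℕₚ.≰⇒> p≰s)))
  ... | yes p≤s = cong mod (sym (begin
      (ι x ℕ.+ ι y) / p              ≡⟨ m/n≡1+[m∸n]/n p≤s ⟩
      1 ℕ.+ (ι x ℕ.+ ι y ∸ p) / p    ≡⟨ cong (1 ℕ.+_) (m<n⇒m/n≡0 s∸p<p) ⟩
      1                              ∎))
    where
    s∸p<p : ι x ℕ.+ ι y ∸ p < p
    s∸p<p = ℕₚ.m<n+o⇒m∸n<o _ p (ℕₚ.+-mono-< (Finₚ.toℕ<n x) (Finₚ.toℕ<n y))

  /-carry : ∀ a b → a / p ℕ.+ (a % p ℕ.+ b) / p ≡ (a ℕ.+ b) / p
  /-carry a b = begin
    a / p ℕ.+ (a % p ℕ.+ b) / p                  ≡⟨ ℕₚ.+-comm (a / p) _ ⟩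
    (a % p ℕ.+ b) / p ℕ.+ a / p                  ≡⟨ cong ((a % p ℕ.+ b) / p ℕ.+_) (m*n/n≡m (a / p) p) ⟨
    (a % p ℕ.+ b) / p ℕ.+ (a / p ℕ.* p) / p      ≡⟨ +-distrib-/-∣ʳ (a % p ℕ.+ b) (n∣m*n (a / p)) ⟨
    (a % p ℕ.+ b ℕ.+ a / p ℕ.* p) / p            ≡⟨ cong (_/ p) (ℕ+.xy∙z≈xz∙y (a % p) b (a / p ℕ.* p)) ⟩
    (a % p ℕ.+ a / p ℕ.* p ℕ.+ b) / p            ≡⟨ cong (λ w → (w ℕ.+ b) / p) (m≡m%n+[m/n]*n a p) ⟨
    (a ℕ.+ b) / p                                ∎

  carry-cocycle : ∀ x y z → carry x y ℕ.+ carry (x +ₚ y) z ≡ carry y z ℕ.+ carry x (y +ₚ z)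
  carry-cocycle x y z = begin
    carry x y ℕ.+ carry (x +ₚ y) z   ≡⟨ carry-sum x y z ⟩
    (ι x ℕ.+ ι y ℕ.+ ι z) / p        ≡⟨ cong (_/ p) (ℕ+.xy∙z≈yz∙x (ι x) (ι y) (ι z)) ⟩
    (ι y ℕ.+ ι z ℕ.+ ι x) / p        ≡⟨ carry-sum y z x ⟨
    carry y z ℕ.+ carry (y +ₚ z) x   ≡⟨ cong (λ w → carry y z ℕ.+ w / p) (ℕₚ.+-comm (ι (y +ₚ z)) (ι x)) ⟩
    carry y z ℕ.+ carry x (y +ₚ z)   ∎
    where
    carry-sum : ∀ x y z → carry x y ℕ.+ carry (x +ₚ y) z ≡ (ι x ℕ.+ ι y ℕ.+ ι z) / p
    carry-sum x y z = trans (cong (λ w → carry x y ℕ.+ (w ℕ.+ ι z) / p) (ι-mod (ι x ℕ.+ ι y)))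
                            (/-carry (ι x ℕ.+ ι y) (ι z))

  φ-normalisedCocycle : IsNormalisedCocycle _+ₚ_ 0ₚ φ
  φ-normalisedCocycle = record
    { cocycle = λ x y z → begin
        φ x y +ₚ φ (x +ₚ y) z                   ≡⟨ cong₂ _+ₚ_ (φ≡mod-carry x y) (φ≡mod-carry (x +ₚ y) z) ⟩
        mod (carry x y) +ₚ mod (carry (x +ₚ y) z) ≡⟨ mod-+ (carry x y) (carry (x +ₚ y) z) ⟩
        mod (carry x y ℕ.+ carry (x +ₚ y) z)      ≡⟨ cong mod (carry-cocycle x y z) ⟩
        mod (carry y z ℕ.+ carry x (y +ₚ z))      ≡⟨ mod-+ (carry y z) (carry x (y +ₚ z)) ⟨
        mod (carry y z) +ₚ mod (carry x (y +ₚ z)) ≡⟨ cong₂ _+ₚ_ (φ≡mod-carry y z) (φ≡mod-carry x (y +ₚ z)) ⟨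
        φ y z +ₚ φ x (y +ₚ z)                   ∎
    ; zeroˡ = λ x → trans (φ≡mod-carry 0ₚ x) (cong mod (m<n⇒m/n≡0 (Finₚ.toℕ<n x)))
    ; zeroʳ = λ x → trans (φ≡mod-carry x 0ₚ)
        (cong mod (m<n⇒m/n≡0 (subst (_< p) (sym (ℕₚ.+-identityʳ (ι x))) (Finₚ.toℕ<n x))))
    }

  biadditive⇒normalisedCocycle : ∀ {κ} →
    (∀ x y z → κ (x +ᴾ y) z ≡ κ x z +ₚ κ y z) →
    (∀ x y z → κ x (y +ᴾ z) ≡ κ x y +ₚ κ x z) →
    IsNormalisedCocycle _+ᴾ_ 0ᴾ κ
  biadditive⇒normalisedCocycle {κ} additiveˡ additiveʳ = record
    { cocycle = λ x y z → begin
        κ x y +ₚ κ (x +ᴾ y) z        ≡⟨ cong (κ x y +ₚ_) (additiveˡ x y z) ⟩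
        κ x y +ₚ (κ x z +ₚ κ y z)    ≡⟨ Zp+.x∙yz≈z∙xy (κ x y) (κ x z) (κ y z) ⟩
        κ y z +ₚ (κ x y +ₚ κ x z)    ≡⟨ cong (κ y z +ₚ_) (additiveʳ x y z) ⟨
        κ y z +ₚ κ x (y +ᴾ z)        ∎
    ; zeroˡ = λ x → identityˡ-unique (κ 0ᴾ x) (κ 0ᴾ x)
        (trans (sym (additiveˡ 0ᴾ 0ᴾ x)) (cong (λ w → κ w x) (Pᵍ.identityˡ 0ᴾ)))
    ; zeroʳ = λ x → identityʳ-unique (κ x 0ᴾ) (κ x 0ᴾ)
        (trans (sym (additiveʳ x 0ᴾ 0ᴾ)) (cong (κ x) (Pᵍ.identityˡ 0ᴾ)))
    }

  κ₊-normalisedCocycle : IsNormalisedCocycle _+ᴾ_ 0ᴾ κ₊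
  κ₊-normalisedCocycle = biadditive⇒normalisedCocycle
    (λ (_ , b) (_ , e) (f , _) → dot-distribʳ b e f)
    (λ (_ , b) (c , _) (f , _) → dot-distribˡ b c f)

  κ₋-normalisedCocycle : IsNormalisedCocycle _+ᴾ_ 0ᴾ κ₋
  κ₋-normalisedCocycle = +-normalisedCocycle κ₊-normalisedCocycle
    (pullback-normalisedCocycle (λ x → first (proj₁ x)) (λ (a , _) (c , _) → first-+ a c) first-0
      φ-normalisedCocycle)

  Step : (P → P → Zp) → G → G → Set
  Step κ g h = Σ P λ s → InS s × g ≡ mul κ (ε s) h

  module _ {κ : P → P → Zp} (κ-cocycle : IsNormalisedCocycle _+ᴾ_ 0ᴾ κ) where
    open IsNormalisedCocycle κ-cocycle

    κ-inverse-comm : ∀ x → κ (-ᴾ x) x ≡ κ x (-ᴾ x)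
    κ-inverse-comm x = begin
      κ (-ᴾ x) x                        ≡⟨ +-identityʳ (κ (-ᴾ x) x) ⟨
      κ (-ᴾ x) x +ₚ 0ₚ                  ≡⟨ cong (κ (-ᴾ x) x +ₚ_) (trans (cong (κ x) (Pᵍ.inverseˡ x)) (zeroʳ x)) ⟨
      κ (-ᴾ x) x +ₚ κ x ((-ᴾ x) +ᴾ x)   ≡⟨ cocycle x (-ᴾ x) x ⟨
      κ x (-ᴾ x) +ₚ κ (x +ᴾ (-ᴾ x)) x   ≡⟨ cong (κ x (-ᴾ x) +ₚ_) (trans (cong (λ w → κ w x) (Pᵍ.inverseʳ x)) (zeroˡ x)) ⟩
      κ x (-ᴾ x) +ₚ 0ₚ                  ≡⟨ +-identityʳ (κ x (-ᴾ x)) ⟩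
      κ x (-ᴾ x)                        ∎

    mul-assoc : ∀ g h k → mul κ (mul κ g h) k ≡ mul κ g (mul κ h k)
    mul-assoc (x , z) (y , w) (u , t) = cong₂ _,_ (Pᵍ.assoc x y u) (begin
      (((z +ₚ w) +ₚ κ x y) +ₚ t) +ₚ κ (x +ᴾ y) u
        ≡⟨ solve 5 (λ z w t a b → (((z ⊕ w) ⊕ a) ⊕ t) ⊕ b ⊜ ((z ⊕ w) ⊕ t) ⊕ (a ⊕ b))
                   refl z w t (κ x y) (κ (x +ᴾ y) u) ⟩
      ((z +ₚ w) +ₚ t) +ₚ (κ x y +ₚ κ (x +ᴾ y) u)
        ≡⟨ cong (((z +ₚ w) +ₚ t) +ₚ_) (cocycle x y u) ⟩
      ((z +ₚ w) +ₚ t) +ₚ (κ y u +ₚ κ x (y +ᴾ u))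
        ≡⟨ solve 5 (λ z w t a b → ((z ⊕ w) ⊕ t) ⊕ (a ⊕ b) ⊜ (z ⊕ ((w ⊕ t) ⊕ a)) ⊕ b)
                   refl z w t (κ y u) (κ x (y +ᴾ u)) ⟩
      (z +ₚ ((w +ₚ t) +ₚ κ y u)) +ₚ κ x (y +ᴾ u) ∎)

    mul-identityˡ : ∀ g → mul κ (0ᴾ , 0ₚ) g ≡ g
    mul-identityˡ (x , z) = cong₂ _,_ (Pᵍ.identityˡ x)
      (trans (cong₂ _+ₚ_ (+-identityˡ z) (zeroˡ x)) (+-identityʳ z))

    mul-identityʳ : ∀ g → mul κ g (0ᴾ , 0ₚ) ≡ g
    mul-identityʳ (x , z) = cong₂ _,_ (Pᵍ.identityʳ x)
      (trans (cong₂ _+ₚ_ (+-identityʳ z) (zeroʳ x)) (+-identityʳ z))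

    mul-inverseˡ : ∀ g → mul κ (inv κ g) g ≡ (0ᴾ , 0ₚ)
    mul-inverseˡ (x , z) = cong₂ _,_ (Pᵍ.inverseˡ x) (begin
      ((-ₚ (z +ₚ c)) +ₚ z) +ₚ κ (-ᴾ x) x  ≡⟨ cong (((-ₚ (z +ₚ c)) +ₚ z) +ₚ_) (κ-inverse-comm x) ⟩
      ((-ₚ (z +ₚ c)) +ₚ z) +ₚ c           ≡⟨ +-assoc (-ₚ (z +ₚ c)) z c ⟩
      (-ₚ (z +ₚ c)) +ₚ (z +ₚ c)           ≡⟨ -‿inverseˡ (z +ₚ c) ⟩
      0ₚ                                  ∎)
      where c = κ x (-ᴾ x)

    mul-inverseʳ : ∀ g → mul κ g (inv κ g) ≡ (0ᴾ , 0ₚ)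
    mul-inverseʳ (x , z) = cong₂ _,_ (Pᵍ.inverseʳ x) (begin
      (z +ₚ (-ₚ (z +ₚ c))) +ₚ c  ≡⟨ Zp+.xy∙z≈xz∙y z (-ₚ (z +ₚ c)) c ⟩
      (z +ₚ c) +ₚ (-ₚ (z +ₚ c))  ≡⟨ -‿inverseʳ (z +ₚ c) ⟩
      0ₚ                         ∎)
      where c = κ x (-ᴾ x)

    G-group : Group _ _
    G-group = record
      { Carrier = G ; _≈_ = _≡_ ; _∙_ = mul κ ; ε = (0ᴾ , 0ₚ) ; _⁻¹ = inv κ
      ; isGroup = record
        { isMonoid = record
          { isSemigroup = record
            { isMagma = record { isEquivalence = isEquivalence ; ∙-cong = cong₂ (mul κ) }
            ; assoc = mul-assoc }
          ; identity = mul-identityˡ , mul-identityʳ }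
        ; inverse = mul-inverseˡ , mul-inverseʳ
        ; ⁻¹-cong = cong (inv κ) } }

    Cayley-adj⇔ : ∀ {g h} → CayAdj κ g h ⇔ (Step κ g h ⊎ Step κ h g)
    Cayley-adj⇔ {g} {h} = mk⇔
      (λ { (s , s∈S , inj₁ e) → inj₁ (s , s∈S , Equivalence.to (left s) e)
         ; (s , s∈S , inj₂ e) → inj₂ (s , s∈S , Equivalence.to (right s) e) })
      (λ { (inj₁ (s , s∈S , e)) → s , s∈S , inj₁ (Equivalence.from (left s) e)
         ; (inj₂ (s , s∈S , e)) → s , s∈S , inj₂ (Equivalence.from (right s) e) })
      where
      left : ∀ s → (mul κ g (inv κ h) ≡ ε s) ⇔ (g ≡ mul κ (ε s) h)
      left s = //≈⇔≈∙ G-group {g} {h} {ε s}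
      right : ∀ s → (mul κ g (inv κ h) ≡ inv κ (ε s)) ⇔ (h ≡ mul κ (ε s) g)
      right s = //≈⁻¹⇔≈∙ G-group {g} {h} {ε s}

  ψ : G → G
  ψ (x , z) = (x , -ₚ z)

  ψ-involutive : ∀ g → ψ (ψ g) ≡ g
  ψ-involutive (x , z) = cong (x ,_) (Zpₚ.⁻¹-involutive z)

  GainStep : (P → P → Zp) → G → G → Set
  GainStep κ (v , j) (u , k) = InS (v +ᴾ (-ᴾ u)) × k ≡ j +ₚ κ (v +ᴾ (-ᴾ u)) u

  -ₚ≡⇔≡+ₚ : ∀ j k a → (-ₚ j ≡ (0ₚ +ₚ (-ₚ k)) +ₚ a) ⇔ (k ≡ j +ₚ a)
  -ₚ≡⇔≡+ₚ j k a = mk⇔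
    (λ e → Equivalence.to k-a≡j⇔k≡j+a (sym (Zpₚ.⁻¹-injective (trans e -[k-a]))))
    (λ e → trans (cong -ₚ_ (sym (Equivalence.from k-a≡j⇔k≡j+a e))) (sym -[k-a]))
    where
    k-a≡j⇔k≡j+a : (k +ₚ (-ₚ a) ≡ j) ⇔ (k ≡ j +ₚ a)
    k-a≡j⇔k≡j+a = //≈⇔≈∙ +-group
    -[k-a] : (0ₚ +ₚ (-ₚ k)) +ₚ a ≡ -ₚ (k +ₚ (-ₚ a))
    -[k-a] = begin
      (0ₚ +ₚ (-ₚ k)) +ₚ a         ≡⟨ cong (_+ₚ a) (+-identityˡ (-ₚ k)) ⟩
      (-ₚ k) +ₚ a                 ≡⟨ cong ((-ₚ k) +ₚ_) (Zpₚ.⁻¹-involutive a) ⟨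
      (-ₚ k) +ₚ (-ₚ (-ₚ a))       ≡⟨ Zpₚ.⁻¹-∙-comm k (-ₚ a) ⟩
      -ₚ (k +ₚ (-ₚ a))            ∎

  gainStep⇔step-ψ : ∀ {κ} x y → GainStep κ x y ⇔ Step κ (ψ x) (ψ y)
  gainStep⇔step-ψ {κ} (v , j) (u , k) = mk⇔
    (λ (v-u∈S , k≡) → v +ᴾ (-ᴾ u) , v-u∈S ,
       cong₂ _,_ (Equivalence.to (//≈⇔≈∙ P-group {v} {u}) refl)
                 (Equivalence.from (-ₚ≡⇔≡+ₚ j k (κ (v +ᴾ (-ᴾ u)) u)) k≡))
    (λ (s , s∈S , e) → let v-u≡s = Equivalence.from (//≈⇔≈∙ P-group {v} {u} {s}) (cong proj₁ e) in
       subst InS (sym v-u≡s) s∈S ,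
       trans (Equivalence.to (-ₚ≡⇔≡+ₚ j k (κ s u)) (cong proj₂ e)) (cong (λ t → j +ₚ κ t u) (sym v-u≡s)))

  gain≡just⇒ : ∀ {κ u v c} → gain κ u v ≡ just c →
    (InS (v +ᴾ (-ᴾ u)) × κ (v +ᴾ (-ᴾ u)) u ≡ c) ⊎ (InS (u +ᴾ (-ᴾ v)) × -ₚ κ (u +ᴾ (-ᴾ v)) v ≡ c)
  gain≡just⇒ {κ} {u} {v} eq with InS? (v +ᴾ (-ᴾ u)) | InS? (u +ᴾ (-ᴾ v))
  ... | yes v-u∈S | _        = inj₁ (v-u∈S , just-injective eq)
  ... | no _      | yes u-v∈S = inj₂ (u-v∈S , just-injective eq)
  gain≡just⇒ () | no _ | no _

  gain-yes : ∀ {κ u v} → InS (v +ᴾ (-ᴾ u)) → gain κ u v ≡ just (κ (v +ᴾ (-ᴾ u)) u)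
  gain-yes {κ} {u} {v} v-u∈S with InS? (v +ᴾ (-ᴾ u))
  ... | yes _     = refl
  ... | no v-u∉S = ⊥-elim (v-u∉S v-u∈S)

  gain-no : ∀ {κ u v} → ¬ InS (v +ᴾ (-ᴾ u)) → InS (u +ᴾ (-ᴾ v)) →
            gain κ u v ≡ just (-ₚ κ (u +ᴾ (-ᴾ v)) v)
  gain-no {κ} {u} {v} v-u∉S u-v∈S with InS? (v +ᴾ (-ᴾ u)) | InS? (u +ᴾ (-ᴾ v))
  ... | yes v-u∈S | _        = ⊥-elim (v-u∉S v-u∈S)
  ... | no _      | yes _    = refl
  ... | no _      | no u-v∉S = ⊥-elim (u-v∉S u-v∈S)

  cover-adj⇔ : ∀ {κ} → (∀ {s} → InS s → ¬ InS (-ᴾ s)) →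
               ∀ x y → CoverAdj (gain κ) x y ⇔ (GainStep κ x y ⊎ GainStep κ y x)
  cover-adj⇔ {κ} S∩-S≡∅ (v , j) (u , k) = mk⇔ to from
    where
    to : CoverAdj (gain κ) (v , j) (u , k) → GainStep κ (v , j) (u , k) ⊎ GainStep κ (u , k) (v , j)
    to (_ , c , gain≡c , k≡j+c) with gain≡just⇒ gain≡c
    ... | inj₁ (v-u∈S , refl) = inj₁ (v-u∈S , k≡j+c)
    ... | inj₂ (u-v∈S , refl) =
      inj₂ (u-v∈S , Equivalence.to (//≈⇔≈∙ +-group {j} {κ (u +ᴾ (-ᴾ v)) v}) (sym k≡j+c))
    from : GainStep κ (v , j) (u , k) ⊎ GainStep κ (u , k) (v , j) → CoverAdj (gain κ) (v , j) (u , k)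
    from (inj₁ (v-u∈S , k≡)) =
      inj₂ (v +ᴾ (-ᴾ u) , v-u∈S , sym (Pₚ.⁻¹-anti-homo-// v u)) , _ , gain-yes {κ} v-u∈S , k≡
    from (inj₂ (u-v∈S , j≡)) =
      inj₁ u-v∈S , _ , gain-no {κ} v-u∉S u-v∈S ,
      sym (Equivalence.from (//≈⇔≈∙ +-group {j} {κ (u +ᴾ (-ᴾ v)) v}) j≡)
      where
      v-u∉S : ¬ InS (v +ᴾ (-ᴾ u))
      v-u∉S v-u∈S = S∩-S≡∅ u-v∈S (subst InS (sym (Pₚ.⁻¹-anti-homo-// u v)) v-u∈S)

  cover≅Cayley : ∀ {κ} → IsNormalisedCocycle _+ᴾ_ 0ᴾ κ → (∀ {s} → InS s → ¬ InS (-ᴾ s)) →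
                 GraphIso (CoverAdj (gain κ)) (CayAdj κ)
  cover≅Cayley {κ} κ-cocycle S∩-S≡∅ = mk↔ₛ′ ψ ψ ψ-involutive ψ-involutive , λ x y →
    let adj⇔ = ⇔-sym (Cayley-adj⇔ κ-cocycle)
               ⇔-∘ ((gainStep⇔step-ψ {κ} x y ⊎-⇔ gainStep⇔step-ψ {κ} y x)
               ⇔-∘ cover-adj⇔ {κ} S∩-S≡∅ x y)
    in Equivalence.to adj⇔ , Equivalence.from adj⇔

module Modulus≥3 (k n : ℕ) where
  open Construction (3 ℕ.+ k) (suc n) (s≤s z≤n)
  open ConstructionProperties (2 ℕ.+ k) (suc n) (s≤s z≤n)

  data LeadingPair : Zp → Zp → Set where
    one-zero : LeadingPair 1ₚ 0ₚ
    one-one  : LeadingPair 1ₚ 1ₚ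
    two-one  : LeadingPair 2ₚ 1ₚ

  leadingPair : ∀ {s} → InS s → LeadingPair (first (proj₁ s)) (first (proj₂ s))
  leadingPair (zero  , inj₁ refl) = one-zero
  leadingPair (suc _ , inj₁ refl) = one-one
  leadingPair (zero  , inj₂ refl) = two-one
  leadingPair (suc _ , inj₂ refl) = one-one

  -- With p = 3 + k all these sums compute to numerals below 3.
  leadingPair-sum≢0 : ∀ {a b a′ b′} → LeadingPair a b → LeadingPair a′ b′ →
                      (a +ₚ a′ , b +ₚ b′) ≢ (0ₚ , 0ₚ)
  leadingPair-sum≢0 one-zero one-zero ()
  leadingPair-sum≢0 one-zero one-one  ()
  leadingPair-sum≢0 one-zero two-one  ()
  leadingPair-sum≢0 one-one  one-zero ()
  leadingPair-sum≢0 one-one  one-one  ()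
  leadingPair-sum≢0 one-one  two-one  ()
  leadingPair-sum≢0 two-one  one-zero ()
  leadingPair-sum≢0 two-one  one-one  ()
  leadingPair-sum≢0 two-one  two-one  ()

  S∩-S≡∅ : ∀ {s} → InS s → ¬ InS (-ᴾ s)
  S∩-S≡∅ {a , b} s∈S -s∈S =
    leadingPair-sum≢0 (leadingPair s∈S) (leadingPair -s∈S) (cong₂ _,_ (first+first- a) (first+first- b))
    where
    first+first- : ∀ a → first a +ₚ first (-ᵥ a) ≡ 0ₚ
    first+first- a = trans (sym (first-+ a (-ᵥ a)))
      (trans (cong first (IsAbelianGroup.inverseʳ Vd-isAbelianGroup a)) first-0)

proposition6p1 : (p : ℕ) → {{_ : NonZero p}} → Prime p → 2 ∤ p →
    (d : ℕ) → (hd : 1 ≤ d) →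
    let open Construction p d hd in
    GraphIso (CoverAdj (gain κ₊)) (CayAdj κ₊) ×
    GraphIso (CoverAdj (gain κ₋)) (CayAdj κ₋)
proposition6p1 zero             p-prime _ _ _ = ⊥-elim (¬prime[0] p-prime)
proposition6p1 (suc zero)       p-prime _ _ _ = ⊥-elim (¬prime[1] p-prime)
proposition6p1 (suc (suc zero)) _ 2∤2 _ _ = ⊥-elim (2∤2 ∣-refl)
proposition6p1 (suc (suc (suc k))) _ _ (suc n) (s≤s z≤n) =
  cover≅Cayley κ₊-normalisedCocycle S∩-S≡∅ , cover≅Cayley κ₋-normalisedCocycle S∩-S≡∅
  where
  open ConstructionProperties (suc (suc k)) (suc n) (s≤s z≤n)
  open Modulus≥3 k n
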